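{- Let $G$ be a polyhedral graph and $\hat\imath\hat\jmath$ an edge of $G$ such that $G/\hat\imath\hat\jmath$ is also a polyhedral graph. Then either $G$ contains a triangular face that is not incident to the edge $\hat\imath\hat\jmath$, or $G$ contains a vertex of degree three that is not incident to the edge $\hat\imath\hat\jmath$.
   Context: A polyhedral graph is a $3$-connected planar graph; its faces are the boundary cycles of its essentially unique planar embedding. $G/\hat\imath\hat\jmath$ denotes edge contraction (remove the edge, identify its endpoints, delete parallel edges). A face is incident to an edge if the edge lies on its boundary; a vertex is incident to an edge if it is one of its endpoints. -}

module Defs where

open import Data.Nat using (ℕ; zero; suc; _+_; _*_; _≤_; _<_)
open import Data.Bool using (Bool; true; false; if_then_else_; _∨_; _∧_)
open import Data.Fin using (Fin; punchIn; _≟_)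
open import Data.List using (List; length; map; allFin; lookup)
open import Data.Nat.ListAction using (sum)
open import Data.List.Membership.Propositional using (_∉_)
open import Data.Product using (Σ; ∃; ∃-syntax; _×_; _,_)
open import Relation.Nullary using (¬_)
open import Relation.Nullary.Decidable using (isYes)
open import Relation.Binary.PropositionalEquality using (_≡_; _≢_)

Graph : ℕ → Set
Graph n = Fin n → Fin n → Bool

Edge : ∀ {n} → Graph n → Fin n → Fin n → Set
Edge G u v = G u v ≡ true

IsSimple : ∀ {n} → Graph n → Set
IsSimple {n} G = (∀ u v → G u v ≡ G v u) × (∀ u → G u u ≡ false)

boolℕ : Bool → ℕ
boolℕ true  = 1
boolℕ false = 0

degree : ∀ {n} → Graph n → Fin n → ℕ
degree {n} G u = sum (map (λ v → boolℕ (G u v)) (allFin n))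

-- number of darts (ordered adjacent pairs) = 2 |E|
dartCount : ∀ {n} → Graph n → ℕ
dartCount {n} G = sum (map (degree G) (allFin n))

data WalkIn {n} (G : Graph n) (ok : Fin n → Set) : Fin n → Fin n → Set where
  here : ∀ {u} → ok u → WalkIn G ok u u
  step : ∀ {u v w} → ok u → Edge G u v → WalkIn G ok v w → WalkIn G ok u w

ConnectedAvoiding : ∀ {n} → Graph n → List (Fin n) → Set
ConnectedAvoiding {n} G S =
  ∀ u v → u ∉ S → v ∉ S → WalkIn G (λ w → w ∉ S) u v

ThreeConnected : ∀ {n} → Graph n → Set
ThreeConnected {n} G =
  3 < n × (∀ (S : List (Fin n)) → length S ≤ 2 → ConnectedAvoiding G S)

iter : ∀ {A : Set} → ℕ → (A → A) → A → A
iter zero    f x = x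
iter (suc k) f x = f (iter k f x)

-- rot u v = the neighbour of u following v in the cyclic order around u
Rotation : ℕ → Set
Rotation n = Fin n → Fin n → Fin n

IsRotationSystem : ∀ {n} → Graph n → Rotation n → Set
IsRotationSystem {n} G rot =
  (∀ u v → Edge G u v → Edge G u (rot u v)) ×
  (∀ u v v' → Edge G u v → Edge G u v' → rot u v ≡ rot u v' → v ≡ v') ×
  (∀ u v w → Edge G u v → Edge G u w → ∃[ k ] iter k (rot u) v ≡ w)

Dart : ℕ → Set
Dart n = Fin n × Fin n

-- face-tracing permutation on darts; faces are its orbits on darts
faceStep : ∀ {n} → Rotation n → Dart n → Dart n
faceStep rot (u , v) = (v , rot v u)

IsDart : ∀ {n} → Graph n → Dart n → Set
IsDart G (u , v) = Edge G u v

FaceReps : ∀ {n} → Graph n → Rotation n → List (Dart n) → Set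
FaceReps {n} G rot L =
  (∀ p → IsDart G (lookup L p)) ×
  (∀ d → IsDart G d → ∃[ p ] ∃[ k ] iter k (faceStep rot) (lookup L p) ≡ d) ×
  (∀ p q k → iter k (faceStep rot) (lookup L p) ≡ lookup L q → p ≡ q)

-- the rotation system is a planar (spherical) embedding of the connected
-- graph G: Euler's formula V − E + F = 2, written as 2(V + F) = 2E + 4
IsPlanarEmbedding : ∀ {n} → Graph n → Rotation n → Set
IsPlanarEmbedding {n} G rot =
  IsRotationSystem G rot ×
  (∃[ L ] FaceReps G rot L × 2 * (n + length L) ≡ dartCount G + 4)

Polyhedral : ∀ {n} → Graph n → Set
Polyhedral G = IsSimple G × ThreeConnected G × ∃[ rot ] IsPlanarEmbedding G rot

-- Edge contraction G / i j on vertex set Fin m (vertex j is merged into i;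
-- the remaining vertices are indexed through punchIn j).

_==_ : ∀ {n} → Fin n → Fin n → Bool
a == b = isYes (a ≟ b)

contract : ∀ {m} → Graph (suc m) → Fin (suc m) → Fin (suc m) → Graph m
contract G i j a b =
  if a == b then false
  else (G a' b' ∨ (a' == i ∧ G j b') ∨ (b' == i ∧ G j a'))
  where
  a' = punchIn j a
  b' = punchIn j b

AvoidsEdge : ∀ {n} → Rotation n → Dart n → ℕ → Fin n → Fin n → Set
AvoidsEdge rot d len i j =
  ∀ k → k < len → iter k (faceStep rot) d ≢ (i , j) × iter k (faceStep rot) d ≢ (j , i)

TriangularFaceAvoiding : ∀ {n} → Graph n → Rotation n → Fin n → Fin n → Set
TriangularFaceAvoiding G rot i j =
  ∃[ d ] IsDart G d × iter 3 (faceStep rot) d ≡ d × faceStep rot d ≢ d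
         × AvoidsEdge rot d 3 i j

-- In a polyhedral graph every vertex has degree at least 3 and every face
-- has length at least 3.  Suppose no vertex other than i and j has degree 3
-- and no triangular face avoids the edge ij.  Then the degree sum gives
-- 2E ≥ 4V − 2.  Charging four darts to every face (the first four darts of a
-- face of length ≥ 4; the three darts of a triangle through ij together with
-- one of the two darts of ij, which lies on that triangle) is injective, so
-- 4F ≤ 2E + 2.  Adding the two bounds contradicts Euler's formula
-- 4V + 4F = 4E + 8.
module Submission where

open import Defs
open import Data.Bool using (Bool; true; false; if_then_else_)
open import Data.Empty using (⊥; ⊥-elim)
open import Data.Fin using (Fin; toℕ; fromℕ<; remQuot; combine) renaming (zero to fz; suc to fs)
open import Data.Fin.Properties using (toℕ-injective; toℕ<n; toℕ-fromℕ<; any?; injective⇒≤; combine-remQuot) renaming (_≟_ to _≟ᶠ_)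
open import Data.List using (List; []; _∷_; length; map; allFin; lookup; _++_)
open import Data.List.Properties using (length-++; length-map; map-tabulate; length-tabulate; map-cong)
open import Data.List.Membership.Propositional using (_∈_; _∉_)
open import Data.List.Membership.Propositional.Properties using (∈-allFin; ∈-++⁺ˡ; ∈-++⁺ʳ; ∈-map⁺)
import Data.List.Membership.DecPropositional as DecMembership
open import Data.List.Relation.Unary.Any using (here; there; index)
open import Data.List.Relation.Unary.Any.Properties using (lookup-index)
open import Data.Nat using (ℕ; zero; suc; _+_; _*_; _≤_; _<_; z≤n; s≤s)
open import Data.Nat.Properties
open import Data.Nat.ListAction using (sum)
open import Algebra.Properties.CommutativeSemigroup +-commutativeSemigroup using (interchange)
open import Data.Product using (_×_; ∃-syntax; _,_; proj₁; proj₂; uncurry)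
open import Data.Product.Properties using (≡-dec)
open import Data.Sum using (_⊎_; inj₁; inj₂; map₂)
open import Function using (_∘_; id)
open import Function.Definitions using (Injective)
open import Relation.Nullary using (¬_; yes; no)
open import Relation.Nullary.Decidable using (_×-dec_; ¬?; decidable-stable)
open import Relation.Binary.PropositionalEquality

injective⇒≤length : ∀ {N} {A : Set} (f : Fin N → A) (xs : List A)
  → (∀ x → f x ∈ xs) → Injective _≡_ _≡_ f → N ≤ length xs
injective⇒≤length f xs f∈xs f-inj = injective⇒≤ {f = index ∘ f∈xs} λ {x} {y} e → f-inj (begin
  f x                        ≡⟨ lookup-index (f∈xs x) ⟩
  lookup xs (index (f∈xs x)) ≡⟨ cong (lookup xs) e ⟩
  lookup xs (index (f∈xs y)) ≡⟨ lookup-index (f∈xs y) ⟨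
  f y                        ∎)
  where open ≡-Reasoning

injective₂⇒*≤length : ∀ {M K} {A : Set} (f : Fin M × Fin K → A) (xs : List A)
  → (∀ x → f x ∈ xs) → Injective _≡_ _≡_ f → M * K ≤ length xs
injective₂⇒*≤length {M} {K} f xs f∈xs f-inj =
  injective⇒≤length (f ∘ remQuot K) xs (f∈xs ∘ remQuot K) λ {x} {y} e →
    trans (sym (combine-remQuot {M} K x))
          (trans (cong (uncurry combine) (f-inj e)) (combine-remQuot {M} K y))

module _ {n : ℕ} where
  open DecMembership (_≟ᶠ_ {n}) using (_∈?_)

  ∃∉ : (T : List (Fin n)) → length T < n → ∃[ w ] w ∉ T
  ∃∉ T T<n with any? (λ w → ¬? (w ∈? T))
  ... | yes w∉T  = w∉T
  ... | no ¬w∉T = ⊥-elim (<⇒≱ T<n (injective⇒≤length id T all∈T id))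
    where
    all∈T : ∀ w → w ∈ T
    all∈T w = decidable-stable (w ∈? T) (λ w∉T → ¬w∉T (w , w∉T))

some⊎all : ∀ {F} {A : Set} {B : Fin F → Set} → (∀ p → A ⊎ B p) → A ⊎ (∀ p → B p)
some⊎all {zero}  a⊎b = inj₂ λ ()
some⊎all {suc F} a⊎b with a⊎b fz | some⊎all (a⊎b ∘ fs)
... | inj₁ a  | _       = inj₁ a
... | inj₂ _  | inj₁ a  = inj₁ a
... | inj₂ b₀ | inj₂ bs = inj₂ λ { fz → b₀ ; (fs p) → bs p }

sum-map-+ : ∀ {A : Set} (f g : A → ℕ) xs
  → sum (map (λ x → f x + g x) xs) ≡ sum (map f xs) + sum (map g xs)
sum-map-+ f g []       = refl
sum-map-+ f g (x ∷ xs) =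
  trans (cong ((f x + g x) +_) (sum-map-+ f g xs)) (interchange (f x) (g x) (sum (map f xs)) (sum (map g xs)))

*-length≤sum : ∀ {A : Set} c (f : A → ℕ) xs → (∀ x → c ≤ f x) → c * length xs ≤ sum (map f xs)
*-length≤sum c f []       c≤f = ≤-reflexive (*-zeroʳ c)
*-length≤sum c f (x ∷ xs) c≤f rewrite *-suc c (length xs) = +-mono-≤ (c≤f x) (*-length≤sum c f xs c≤f)

sum-allFin-suc : ∀ {N} (f : Fin (suc N) → ℕ)
  → sum (map f (allFin (suc N))) ≡ f fz + sum (map (f ∘ fs) (allFin N))
sum-allFin-suc f = cong (λ xs → f fz + sum xs) (trans (map-tabulate fs f) (sym (map-tabulate id (f ∘ fs))))

sum-map-0 : ∀ {A : Set} (xs : List A) → sum (map (λ _ → 0) xs) ≡ 0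
sum-map-0 []       = refl
sum-map-0 (_ ∷ xs) = sum-map-0 xs

==-suc : ∀ {N} (u i : Fin N) → (fs u == fs i) ≡ (u == i)
==-suc u i with u ≟ᶠ i
... | yes _ = refl
... | no _  = refl

indicator-sum≤1 : ∀ {N} (i : Fin N) → sum (map (λ u → boolℕ (u == i)) (allFin N)) ≤ 1
indicator-sum≤1 {suc N} fz     = ≤-reflexive (trans (sum-allFin-suc {N} (λ u → boolℕ (u == fz))) (cong suc (sum-map-0 (allFin N))))
indicator-sum≤1 {suc N} (fs i) = begin
  sum (map (λ u → boolℕ (u == fs i)) (allFin (suc N)))  ≡⟨ sum-allFin-suc (λ u → boolℕ (u == fs i)) ⟩
  sum (map (λ u → boolℕ (fs u == fs i)) (allFin N))     ≡⟨ cong sum (map-cong (λ u → cong boolℕ (==-suc u i)) (allFin N)) ⟩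
  sum (map (λ u → boolℕ (u == i)) (allFin N))           ≤⟨ indicator-sum≤1 i ⟩
  1                                                     ∎
  where open ≤-Reasoning

4*length≤sum+2 : ∀ {N} (f : Fin N → ℕ) (i j : Fin N)
  → (∀ u → 3 ≤ f u) → (∀ u → u ≢ i → u ≢ j → 4 ≤ f u) → 4 * N ≤ sum (map f (allFin N)) + 2
4*length≤sum+2 {N} f i j 3≤f 4≤f = begin
  4 * N                                    ≡⟨ cong (4 *_) (length-tabulate {n = N} id) ⟨
  4 * length (allFin N)                    ≤⟨ *-length≤sum 4 f+χ (allFin N) 4≤f+χ ⟩
  sum (map f+χ (allFin N))                 ≡⟨ sum-map-+ f (λ u → χ i u + χ j u) (allFin N) ⟩
  sum (map f (allFin N)) + sum (map (λ u → χ i u + χ j u) (allFin N))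
                                           ≡⟨ cong (sum (map f (allFin N)) +_) (sum-map-+ (χ i) (χ j) (allFin N)) ⟩
  sum (map f (allFin N)) + (sum (map (χ i) (allFin N)) + sum (map (χ j) (allFin N)))
                                           ≤⟨ +-monoʳ-≤ (sum (map f (allFin N))) (+-mono-≤ (indicator-sum≤1 i) (indicator-sum≤1 j)) ⟩
  sum (map f (allFin N)) + 2               ∎
  where
  open ≤-Reasoning
  χ : Fin N → Fin N → ℕ
  χ v u = boolℕ (u == v)
  f+χ : Fin N → ℕ
  f+χ u = f u + (χ i u + χ j u)
  4≤f+χ : ∀ u → 4 ≤ f+χ u
  4≤f+χ u with u ≟ᶠ i | u ≟ᶠ j
  ... | yes _  | _      = +-mono-≤ (3≤f u) (s≤s z≤n)
  ... | no _   | yes _  = +-mono-≤ (3≤f u) (s≤s z≤n)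
  ... | no u≢i | no u≢j = ≤-trans (4≤f u u≢i u≢j) (m≤m+n (f u) _)

iter-+ : ∀ {A : Set} (f : A → A) a b x → iter (a + b) f x ≡ iter a f (iter b f x)
iter-+ f zero    b x = refl
iter-+ f (suc a) b x = cong f (iter-+ f a b x)

iter-fixed : ∀ {A : Set} {f : A → A} {x} → f x ≡ x → ∀ k → iter k f x ≡ x
iter-fixed fx≡x zero    = refl
iter-fixed {f = f} fx≡x (suc k) = trans (cong f (iter-fixed fx≡x k)) fx≡x

module Iteration {A : Set} (P : A → Set) (f : A → A)
                 (f-pres : ∀ {x} → P x → P (f x))
                 (f-injective : ∀ {x y} → P x → P y → f x ≡ f y → x ≡ y) where

  iter-pres : ∀ k {x} → P x → P (iter k f x)
  iter-pres zero    px = px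
  iter-pres (suc k) px = f-pres (iter-pres k px)

  iter-injective : ∀ k {x y} → P x → P y → iter k f x ≡ iter k f y → x ≡ y
  iter-injective zero    px py eq = eq
  iter-injective (suc k) px py eq =
    iter-injective k px py (f-injective (iter-pres k px) (iter-pres k py) eq)

  iter-align : ∀ a b {x y} → P x → P y → iter a f x ≡ iter b f y
    → (∃[ c ] x ≡ iter c f y × a + c ≡ b) ⊎ (∃[ c ] iter c f x ≡ y × b + c ≡ a)
  iter-align a b {x} {y} px py eq with ≤-total a b
  ... | inj₁ a≤b with m≤n⇒∃[o]m+o≡n a≤b
  ...   | c , refl = inj₁ (c , iter-injective a px (iter-pres c py) (trans eq (iter-+ f a c y)) , refl)
  iter-align a b {x} {y} px py eq | inj₂ b≤a with m≤n⇒∃[o]m+o≡n b≤a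
  ...   | c , refl = inj₂ (c , iter-injective b (iter-pres c px) py (trans (sym (iter-+ f b c x)) eq) , refl)

  NoReturnWithin : ℕ → A → Set
  NoReturnWithin N x = ∀ c → c < N → iter (suc c) f x ≢ x

  NoReturnWithin-suc : ∀ {N x} → NoReturnWithin N x → iter (suc N) f x ≢ x → NoReturnWithin (suc N) x
  NoReturnWithin-suc nr ¬ret c c<1+N with m<1+n⇒m<n∨m≡n c<1+N
  ... | inj₁ c<N  = nr c c<N
  ... | inj₂ refl = ¬ret

  iter-injective-within : ∀ {N x} → P x → NoReturnWithin N x
    → ∀ {a b} → a ≤ N → b ≤ N → iter a f x ≡ iter b f x → a ≡ b
  iter-injective-within px nr {a} {b} a≤N b≤N eq with iter-align a b px px eq
  ... | inj₁ (zero  , _   , a+0≡b) = trans (sym (+-identityʳ a)) a+0≡b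
  ... | inj₁ (suc c , ret , refl)  = ⊥-elim (nr c (m+n≤o⇒n≤o a b≤N) (sym ret))
  ... | inj₂ (zero  , _   , b+0≡a) = trans (sym b+0≡a) (+-identityʳ b)
  ... | inj₂ (suc c , ret , refl)  = ⊥-elim (nr c (m+n≤o⇒n≤o b a≤N) ret)

module _ {n : ℕ} (G : Graph n) where

  neighboursIn : Fin n → List (Fin n) → List (Fin n)
  neighboursIn u []       = []
  neighboursIn u (v ∷ vs) = if G u v then v ∷ neighboursIn u vs else neighboursIn u vs

  length-neighboursIn : ∀ u vs → length (neighboursIn u vs) ≡ sum (map (λ v → boolℕ (G u v)) vs)
  length-neighboursIn u []       = refl
  length-neighboursIn u (v ∷ vs) with G u v
  ... | true  = cong suc (length-neighboursIn u vs)
  ... | false = length-neighboursIn u vs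

  ∈-neighboursIn : ∀ {u v} vs → v ∈ vs → Edge G u v → v ∈ neighboursIn u vs
  ∈-neighboursIn (_ ∷ vs) (here refl) uv rewrite uv = here refl
  ∈-neighboursIn {u} (w ∷ vs) (there v∈vs) uv with G u w
  ... | true  = there (∈-neighboursIn vs v∈vs uv)
  ... | false = ∈-neighboursIn vs v∈vs uv

  neighbours : Fin n → List (Fin n)
  neighbours u = neighboursIn u (allFin n)

  ∈-neighbours : ∀ {u v} → Edge G u v → v ∈ neighbours u
  ∈-neighbours {v = v} = ∈-neighboursIn (allFin n) (∈-allFin v)

  injective⇒≤degree : ∀ {k} u (f : Fin k → Fin n) → (∀ x → Edge G u (f x)) → Injective _≡_ _≡_ f
    → k ≤ degree G u
  injective⇒≤degree {k} u f adj f-inj = begin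
    k                      ≤⟨ injective⇒≤length f (neighbours u) (∈-neighbours ∘ adj) f-inj ⟩
    length (neighbours u)  ≡⟨ length-neighboursIn u (allFin n) ⟩
    degree G u             ∎
    where open ≤-Reasoning

  dartsFrom : List (Fin n) → List (Dart n)
  dartsFrom []       = []
  dartsFrom (u ∷ us) = map (u ,_) (neighbours u) ++ dartsFrom us

  length-dartsFrom : ∀ us → length (dartsFrom us) ≡ sum (map (degree G) us)
  length-dartsFrom []       = refl
  length-dartsFrom (u ∷ us) = begin
    length (map (u ,_) (neighbours u) ++ dartsFrom us)
      ≡⟨ length-++ (map (u ,_) (neighbours u)) ⟩
    length (map (u ,_) (neighbours u)) + length (dartsFrom us)
      ≡⟨ cong₂ _+_ (length-map (u ,_) (neighbours u)) (length-dartsFrom us) ⟩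
    length (neighbours u) + sum (map (degree G) us)
      ≡⟨ cong (_+ sum (map (degree G) us)) (length-neighboursIn u (allFin n)) ⟩
    degree G u + sum (map (degree G) us)
      ∎
    where open ≡-Reasoning

  ∈-dartsFrom : ∀ {u v} us → u ∈ us → Edge G u v → (u , v) ∈ dartsFrom us
  ∈-dartsFrom (u ∷ us) (here refl)  uv = ∈-++⁺ˡ (∈-map⁺ (u ,_) (∈-neighbours uv))
  ∈-dartsFrom (w ∷ us) (there u∈us) uv = ∈-++⁺ʳ (map (w ,_) (neighbours w)) (∈-dartsFrom us u∈us uv)

  darts : List (Dart n)
  darts = dartsFrom (allFin n)

  length-darts : length darts ≡ dartCount G
  length-darts = length-dartsFrom (allFin n)

  ∈-darts : ∀ {d} → IsDart G d → d ∈ darts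
  ∈-darts {u , _} = ∈-dartsFrom (allFin n) (∈-allFin u)

module _ {n : ℕ} {G : Graph n} (simple : IsSimple G) where

  edge-sym : ∀ {u v} → Edge G u v → Edge G v u
  edge-sym {u} {v} uv = trans (proj₁ simple v u) uv

  edge⇒≢ : ∀ {u v} → Edge G u v → u ≢ v
  edge⇒≢ {u} uv refl with trans (sym uv) (proj₂ simple u)
  ... | ()

walk-first-step : ∀ {n} {G : Graph n} {ok v w} → WalkIn G ok v w → v ≢ w → ∃[ x ] Edge G v x × ok x
walk-first-step (here _)         v≢w = ⊥-elim (v≢w refl)
walk-first-step (step _ vx rest) _   = _ , vx , start rest
  where
  start : ∀ {n} {G : Graph n} {ok x w} → WalkIn G ok x w → ok x
  start (here ok)     = ok
  start (step ok _ _) = ok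

module _ {n : ℕ} {G : Graph n} (simple : IsSimple G) (3-connected : ThreeConnected G) where

  neighbour-avoiding : ∀ v S → length S ≤ 2 → v ∉ S → ∃[ w ] Edge G v w × w ∉ S
  neighbour-avoiding v S |S|≤2 v∉S with ∃∉ (v ∷ S) (≤-trans (s≤s (s≤s |S|≤2)) (proj₁ 3-connected))
  ... | w , w∉v∷S = walk-first-step (proj₂ 3-connected S |S|≤2 v w v∉S (w∉v∷S ∘ there)) (w∉v∷S ∘ here ∘ sym)

  another-neighbour : ∀ {v u} → Edge G v u → ∃[ w ] Edge G v w × w ≢ u
  another-neighbour {v} {u} vu with neighbour-avoiding v (u ∷ []) (s≤s z≤n) (λ { (here v≡u) → edge⇒≢ simple vu v≡u })
  ... | w , vw , w∉u = w , vw , w∉u ∘ here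

  3≤degree : ∀ v → 3 ≤ degree G v
  3≤degree v with neighbour-avoiding v [] z≤n (λ ())
  ... | a , va , _ with neighbour-avoiding v (a ∷ []) (s≤s z≤n) (λ { (here v≡a) → edge⇒≢ simple va v≡a })
  ... | b , vb , b∉a with neighbour-avoiding v (a ∷ b ∷ []) (s≤s (s≤s z≤n))
                            (λ { (here v≡a) → edge⇒≢ simple va v≡a ; (there (here v≡b)) → edge⇒≢ simple vb v≡b })
  ... | c , vc , c∉ab = injective⇒≤degree G v abc adjacent injective
    where
    abc : Fin 3 → Fin n
    abc fz           = a
    abc (fs fz)      = b
    abc (fs (fs fz)) = c
    adjacent : ∀ x → Edge G v (abc x)
    adjacent fz           = va
    adjacent (fs fz)      = vb
    adjacent (fs (fs fz)) = vc
    injective : Injective _≡_ _≡_ abc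
    injective {fz}           {fz}           _ = refl
    injective {fs fz}        {fs fz}        _ = refl
    injective {fs (fs fz)}   {fs (fs fz)}   _ = refl
    injective {fz}           {fs fz}        e = ⊥-elim (b∉a (here (sym e)))
    injective {fs fz}        {fz}           e = ⊥-elim (b∉a (here e))
    injective {fz}           {fs (fs fz)}   e = ⊥-elim (c∉ab (here (sym e)))
    injective {fs (fs fz)}   {fz}           e = ⊥-elim (c∉ab (here e))
    injective {fs fz}        {fs (fs fz)}   e = ⊥-elim (c∉ab (there (here (sym e))))
    injective {fs (fs fz)}   {fs fz}        e = ⊥-elim (c∉ab (there (here e)))

  degree-3⊎4≤degree : ∀ i j → (∃[ v ] degree G v ≡ 3 × v ≢ i × v ≢ j) ⊎ (∀ v → v ≢ i → v ≢ j → 4 ≤ degree G v)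
  degree-3⊎4≤degree i j with any? (λ v → (degree G v ≟ 3) ×-dec (¬? (v ≟ᶠ i) ×-dec ¬? (v ≟ᶠ j)))
  ... | yes degree-3  = inj₁ degree-3
  ... | no ¬degree-3 = inj₂ λ v v≢i v≢j →
    ≤∧≢⇒< (3≤degree v) (λ 3≡degree → ¬degree-3 (v , sym 3≡degree , v≢i , v≢j))

module Faces {n : ℕ} {G : Graph n} (simple : IsSimple G) {rot : Rotation n} (rotation : IsRotationSystem G rot) where

  faceStep-dart : ∀ {d} → IsDart G d → IsDart G (faceStep rot d)
  faceStep-dart {u , v} uv = proj₁ rotation v u (edge-sym simple uv)

  faceStep-injective : ∀ {d d′} → IsDart G d → IsDart G d′ → faceStep rot d ≡ faceStep rot d′ → d ≡ d′
  faceStep-injective {u , v} {u′ , v′} uv u′v′ eq with cong proj₁ eq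
  ... | refl = cong (_, v) (proj₁ (proj₂ rotation) v u u′ (edge-sym simple uv) (edge-sym simple u′v′) (cong proj₂ eq))

  open Iteration (IsDart G) (faceStep rot) faceStep-dart faceStep-injective public

  faceStep-no-fixed : ∀ {d} → IsDart G d → faceStep rot d ≢ d
  faceStep-no-fixed uv eq = edge⇒≢ simple uv (sym (cong proj₁ eq))

  face-length≥3 : (∀ {v u} → Edge G v u → ∃[ w ] Edge G v w × w ≢ u) → ∀ {d} → IsDart G d → NoReturnWithin 2 d
  face-length≥3 _       uv zero          _ = faceStep-no-fixed uv
  face-length≥3 another {u , v} uv (suc zero) _ ret with another (edge-sym simple uv)
  ... | w , vw , w≢u with proj₂ (proj₂ rotation) v u w (edge-sym simple uv) vw
  ... | k , rotᵏu≡w = w≢u (trans (sym rotᵏu≡w) (iter-fixed (cong proj₁ ret) k))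
  face-length≥3 _       _  (suc (suc _)) (s≤s (s≤s ()))

  module Charging {L : List (Dart n)} (reps : FaceReps G rot L)
                  (another : ∀ {v u} → Edge G v u → ∃[ w ] Edge G v w × w ≢ u) (i j : Fin n) where

    F : ℕ
    F = length L

    rep : Fin F → Dart n
    rep = lookup L

    rep-dart : ∀ p → IsDart G (rep p)
    rep-dart = proj₁ reps

    face : Fin F → ℕ → Dart n
    face p a = iter a (faceStep rot) (rep p)

    same-face : ∀ p q a b → face p a ≡ face q b → p ≡ q
    same-face p q a b eq with iter-align a b (rep-dart p) (rep-dart q) eq
    ... | inj₁ (c , e , _) = sym (proj₂ (proj₂ reps) q p c (sym e))
    ... | inj₂ (c , e , _) = proj₂ (proj₂ reps) p q c e

    edgeDarts : List (Dart n)
    edgeDarts = (i , j) ∷ (j , i) ∷ []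

    data FourthDart (p : Fin F) : Set where
      longFace     : NoReturnWithin 3 (rep p) → FourthDart p
      edgeTriangle : (a : Fin 3) → face p (toℕ a) ∈ edgeDarts → FourthDart p

    -- The tag keeps the extra copy of a dart of ij apart from the same dart
    -- charged as one of its triangle's own three darts.
    charge : (p : Fin F) → FourthDart p → Fin 4 → Bool × Dart n
    charge p _                  (fs k) = false , face p (toℕ k)
    charge p (longFace _)       fz     = false , face p 3
    charge p (edgeTriangle a _) fz     = true  , face p (toℕ a)

    charge-on-face : ∀ p e k → ∃[ a ] proj₂ (charge p e k) ≡ face p a
    charge-on-face p _                  (fs k) = toℕ k , refl
    charge-on-face p (longFace _)       fz     = 3 , refl
    charge-on-face p (edgeTriangle a _) fz     = toℕ a , refl

    charge-injective-on-face : ∀ p e {k l} → charge p e k ≡ charge p e l → k ≡ l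
    charge-injective-on-face p e {fz} {fz} _ = refl
    charge-injective-on-face p e {fs k} {fs l} eq = cong fs (toℕ-injective
      (iter-injective-within (rep-dart p) (face-length≥3 another (rep-dart p))
        (≤-pred (toℕ<n k)) (≤-pred (toℕ<n l)) (cong proj₂ eq)))
    charge-injective-on-face p (longFace nr) {fz} {fs l} eq = ⊥-elim (<⇒≢ (toℕ<n l) (sym
      (iter-injective-within (rep-dart p) nr ≤-refl (<⇒≤ (toℕ<n l)) (cong proj₂ eq))))
    charge-injective-on-face p (longFace nr) {fs k} {fz} eq = ⊥-elim (<⇒≢ (toℕ<n k)
      (iter-injective-within (rep-dart p) nr (<⇒≤ (toℕ<n k)) ≤-refl (cong proj₂ eq)))
    charge-injective-on-face p (edgeTriangle _ _) {fz} {fs _} ()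
    charge-injective-on-face p (edgeTriangle _ _) {fs _} {fz} ()

    chargeAll : (∀ p → FourthDart p) → Fin F × Fin 4 → Bool × Dart n
    chargeAll fourth (p , k) = charge p (fourth p) k

    charge-injective : (fourth : ∀ p → FourthDart p) → Injective _≡_ _≡_ (chargeAll fourth)
    charge-injective fourth {p , k} {q , l} eq
      with charge-on-face p (fourth p) k | charge-on-face q (fourth q) l
    ... | a , ea | b , eb with same-face p q a b (trans (sym ea) (trans (cong proj₂ eq) eb))
    ... | refl = cong (p ,_) (charge-injective-on-face p (fourth p) eq)

    tagged : Bool → Dart n → Bool × Dart n
    tagged b d = b , d

    chargeable : List (Bool × Dart n)
    chargeable = map (tagged false) (darts G) ++ map (tagged true) edgeDarts

    length-chargeable : length chargeable ≡ dartCount G + 2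
    length-chargeable = begin
      length chargeable
        ≡⟨ length-++ (map (tagged false) (darts G)) ⟩
      length (map (tagged false) (darts G)) + 2
        ≡⟨ cong (_+ 2) (length-map (tagged false) (darts G)) ⟩
      length (darts G) + 2
        ≡⟨ cong (_+ 2) (length-darts G) ⟩
      dartCount G + 2
        ∎
      where open ≡-Reasoning

    charge-∈ : ∀ p e k → charge p e k ∈ chargeable
    charge-∈ p _                   (fs k) = ∈-++⁺ˡ (∈-map⁺ (tagged false) (∈-darts G (iter-pres (toℕ k) (rep-dart p))))
    charge-∈ p (longFace _)        fz     = ∈-++⁺ˡ (∈-map⁺ (tagged false) (∈-darts G (iter-pres 3 (rep-dart p))))
    charge-∈ p (edgeTriangle _ on) fz     = ∈-++⁺ʳ (map (tagged false) (darts G)) (∈-map⁺ (tagged true) on)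

    4*faces≤darts+2 : (∀ p → FourthDart p) → F * 4 ≤ dartCount G + 2
    4*faces≤darts+2 fourth = begin
      F * 4              ≤⟨ injective₂⇒*≤length _ chargeable (λ (p , k) → charge-∈ p (fourth p) k) (charge-injective fourth) ⟩
      length chargeable  ≡⟨ length-chargeable ⟩
      dartCount G + 2    ∎
      where open ≤-Reasoning

    open DecMembership (≡-dec (_≟ᶠ_ {n}) (_≟ᶠ_ {n})) using (_∈?_)

    triangle⊎fourthDart : ∀ p → TriangularFaceAvoiding G rot i j ⊎ FourthDart p
    triangle⊎fourthDart p with ≡-dec _≟ᶠ_ _≟ᶠ_ (face p 3) (rep p)
    ... | no ¬closes = inj₂ (longFace (NoReturnWithin-suc (face-length≥3 another (rep-dart p)) ¬closes))
    ... | yes closes with any? (λ (a : Fin 3) → face p (toℕ a) ∈? edgeDarts)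
    ...   | yes (a , on) = inj₂ (edgeTriangle a on)
    ...   | no ¬on = inj₁ (rep p , rep-dart p , closes , faceStep-no-fixed (rep-dart p) , avoids)
      where
      avoids : AvoidsEdge rot (rep p) 3 i j
      avoids k k<3 = off ∘ here , off ∘ there ∘ here
        where
        off : face p k ∉ edgeDarts
        off on = ¬on (fromℕ< k<3 , subst (λ a → face p a ∈ edgeDarts) (sym (toℕ-fromℕ< k<3)) on)

    triangle⊎4*faces≤darts+2 : TriangularFaceAvoiding G rot i j ⊎ F * 4 ≤ dartCount G + 2
    triangle⊎4*faces≤darts+2 = map₂ 4*faces≤darts+2 (some⊎all triangle⊎fourthDart)

euler-contradiction : ∀ V F D → 2 * (V + F) ≡ D + 4 → 4 * V ≤ D + 2 → F * 4 ≤ D + 2 → ⊥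
euler-contradiction V F D euler 4V≤ 4F≤ = 4≰2 (+-cancelˡ-≤ D 4 2 (*-cancelˡ-≤ 2 (begin
  2 * (D + 4)        ≡⟨ cong (2 *_) euler ⟨
  2 * (2 * (V + F))  ≡⟨ *-assoc 2 2 (V + F) ⟨
  4 * (V + F)        ≡⟨ *-distribˡ-+ 4 V F ⟩
  4 * V + 4 * F      ≡⟨ cong (4 * V +_) (*-comm 4 F) ⟩
  4 * V + F * 4      ≤⟨ +-mono-≤ 4V≤ 4F≤ ⟩
  (D + 2) + (D + 2)  ≡⟨ cong ((D + 2) +_) (+-identityʳ (D + 2)) ⟨
  2 * (D + 2)        ∎)))
  where
  open ≤-Reasoning
  4≰2 : ¬ (4 ≤ 2)
  4≰2 (s≤s (s≤s ()))

lemma5p15 : ∀ {m} (G : Graph (suc m)) (i j : Fin (suc m))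
    → Polyhedral G → Edge G i j → Polyhedral (contract G i j)
    → ∀ (rot : Rotation (suc m)) → IsPlanarEmbedding G rot
    → TriangularFaceAvoiding G rot i j
      ⊎ (∃[ v ] degree G v ≡ 3 × v ≢ i × v ≢ j)
lemma5p15 {m} G i j (simple , 3-connected , _) _ _ rot (rotation , L , reps , euler)
  with degree-3⊎4≤degree simple 3-connected i j
     | Faces.Charging.triangle⊎4*faces≤darts+2 simple rotation {L} reps (another-neighbour simple 3-connected) i j
... | inj₁ degree-3 | _             = inj₂ degree-3
... | inj₂ _        | inj₁ triangle = inj₁ triangle
... | inj₂ 4≤degree | inj₂ 4F≤D+2   = ⊥-elim (euler-contradiction (suc m) (length L) (dartCount G) euler
  (4*length≤sum+2 (degree G) i j (3≤degree simple 3-connected) 4≤degree) 4F≤D+2)
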